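{- Let $n,k$ be positive integers with $n \geq 3(n-k)$ and $n \geq k$, and let $C$ be a linear chord diagram with $n+1$ chords (on $\{1,\dots,2n+2\}$) in which every chord has length at least $k+1$. Let $M=\{k+2,k+3,\dots,2n-k+1\}$, and let $S_C$ be the set of chords of $C$ having neither endpoint in $M$. Let $a$ be the chord of $C$ whose end point is $2n-k+2$, and let $m$ be the number of chords $b\in S_C$ with $s_b<s_a$. Then $m<n-k+1$.
   Context: A linear chord diagram with $N$ chords is a partition of $\{1,2,\dots,2N\}$ into blocks of size two, called chords. For a chord $c=\{s_c,e_c\}$ with $s_c<e_c$, $s_c$ is its start point, $e_c$ its end point, and its length is $e_c-s_c$. -}

module Defs where

open import Data.Nat using (ℕ; suc; _+_; _*_; _∸_; _≤_; _<_; _≤?_; _<?_)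
open import Data.List using (List; map; filter; length; upTo)
open import Data.Product using (_×_)
open import Relation.Binary.PropositionalEquality using (_≡_; _≢_)
open import Relation.Nullary using (¬_)
open import Relation.Nullary.Decidable using (_×-dec_; ¬?)

InRange : ℕ → ℕ → Set
InRange N i = 1 ≤ i × i ≤ 2 * N

-- A linear chord diagram with N chords: a partition of {1,..,2N} into
-- blocks of size two, encoded by the fixed-point-free involution
-- sending each point to the other point of its chord.
record ChordDiagram (N : ℕ) : Set where
  field
    partner       : ℕ → ℕ
    partner-range : ∀ i → InRange N i → InRange N (partner i)
    partner-nofix : ∀ i → InRange N i → partner i ≢ i
    partner-invol : ∀ i → InRange N i → partner (partner i) ≡ i
open ChordDiagram public

AllLengthsAtLeast : ∀ {N} → ChordDiagram N → ℕ → Set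
AllLengthsAtLeast {N} C L =
  ∀ s → InRange N s → s < partner C s → L ≤ partner C s ∸ s

points : ℕ → List ℕ
points N = map suc (upTo (2 * N))

InM : ℕ → ℕ → ℕ → Set
InM n k x = k + 2 ≤ x × x ≤ (2 * n ∸ k) + 1

-- m = number of chords b of C with neither endpoint in M (b ∈ S_C) and
-- start point s_b < sa.  Each chord is counted once, via its start point s
-- (s < partner s).
countSBefore : ∀ {N} → ChordDiagram N → ℕ → ℕ → ℕ → ℕ
countSBefore {N} C n k sa = length (filter dec (points N))
  where
  dec = λ s → (s <? partner C s)
              ×-dec (¬? ((k + 2 ≤? s) ×-dec (s ≤? (2 * n ∸ k) + 1)))
              ×-dec (¬? ((k + 2 ≤? partner C s) ×-dec (partner C s ≤? (2 * n ∸ k) + 1)))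
              ×-dec (s <? sa)

-- Let a = {sa, e} and t = e − (k+1), so sa ≤ t. Every point of the window t < y < e lies at
-- distance at least k+1 from its partner, so that partner lies before t or after e. The points
-- counted by m lie before sa and their partners at or after e. Hence the m counted points, sa and
-- the k points of the window meet every chord at most once, and a chord diagram with n+1 chords
-- admits at most n+1 such points: m + 1 + k ≤ n + 1.
module Submission where

open import Data.Empty using (⊥-elim)
open import Data.List using ([]; _∷_; map; filter; length; _++_; applyUpTo)
open import Data.List.Membership.Propositional using (_∈_; _∉_)
open import Data.List.Membership.Propositional.Properties using (∈-map⁻; ∈-upTo⁻)
open import Data.List.Properties
  using (filter-accept; filter-reject; filter-all; length-++; length-map; length-applyUpTo;
         map-∘; map-id-local)
open import Data.List.Relation.Binary.Disjoint.Propositional using (Disjoint)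
open import Data.List.Relation.Unary.All as All using (All; []; _∷_)
import Data.List.Relation.Unary.All.Properties as All
open import Data.List.Relation.Unary.Unique.Propositional using (Unique; []; _∷_)
import Data.List.Relation.Unary.Unique.Propositional.Properties as Unique
open import Data.Nat using (ℕ; zero; suc; _+_; _*_; _∸_; _≤_; _<_; _≤?_; _<?_; z≤n; s≤s; z<s)
open import Data.Nat.Properties
open import Data.Product using (_×_; _,_; proj₁; proj₂)
open import Data.Sum using (_⊎_; inj₁; inj₂)
open import Relation.Binary.PropositionalEquality
open import Relation.Binary.Definitions using (tri<; tri≈; tri>)
open import Relation.Nullary using (¬_; Dec; yes; no)
open import Relation.Nullary.Decidable using (_×-dec_; ¬?)

open import Defs

separated⇒disjoint : ∀ {t xs ys} → All (_< t) xs → All (t ≤_) ys → Disjoint xs ys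
separated⇒disjoint xs<t t≤ys (v∈xs , v∈ys) =
  <⇒≱ (All.lookup xs<t v∈xs) (All.lookup t≤ys v∈ys)

length≤1+length-filter : ∀ B {xs} → Unique xs → All (_≤ suc B) xs →
                         length xs ≤ suc (length (filter (_≤? B) xs))
length≤1+length-filter B {[]} [] [] = z≤n
length≤1+length-filter B {x ∷ xs} (x∉xs ∷ u) (x≤1+B ∷ xs≤1+B) with x ≤? B
... | yes x≤B rewrite filter-accept (_≤? B) {xs = xs} x≤B =
  s≤s (length≤1+length-filter B u xs≤1+B)
... | no x≰B rewrite filter-reject (_≤? B) {xs = xs} x≰B =
  s≤s (≤-reflexive (cong length (sym (filter-all (_≤? B) (All.zipWith below (x∉xs , xs≤1+B))))))
  where
  below : ∀ {y} → x ≢ y × y ≤ suc B → y ≤ B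
  below (x≢y , y≤1+B) =
    m<1+n⇒m≤n (≤∧≢⇒< y≤1+B λ y≡1+B → x≢y (trans (≤-antisym x≤1+B (≰⇒> x≰B)) (sym y≡1+B)))

unique⇒length≤ : ∀ B {xs} → Unique xs → All (λ x → 1 ≤ x × x ≤ B) xs → length xs ≤ B
unique⇒length≤ zero {[]} _ _ = z≤n
unique⇒length≤ zero {_ ∷ _} _ ((1≤x , x≤0) ∷ _) = ⊥-elim (<⇒≱ 1≤x x≤0)
unique⇒length≤ (suc B) {xs} u inRange = begin
  length xs                            ≤⟨ length≤1+length-filter B u (All.map proj₂ inRange) ⟩
  suc (length (filter (_≤? B) xs))     ≤⟨ s≤s (unique⇒length≤ B (Unique.filter⁺ (_≤? B) u) below) ⟩
  suc B                                ∎
  where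
  open ≤-Reasoning
  below : All (λ x → 1 ≤ x × x ≤ B) (filter (_≤? B) xs)
  below = All.zip (All.filter⁺ (_≤? B) (All.map proj₁ inRange) , All.all-filter (_≤? B) xs)

module _ {N : ℕ} (C : ChordDiagram N) where

  private
    p : ℕ → ℕ
    p = partner C

  partner-above⇒far : ∀ {L x} → AllLengthsAtLeast C L → InRange N x → x < p x → x + L ≤ p x
  partner-above⇒far {L} {x} long x∈ x<px = begin
    x + L           ≤⟨ +-monoʳ-≤ x (long x x∈ x<px) ⟩
    x + (p x ∸ x)   ≡⟨ m+[n∸m]≡n (<⇒≤ x<px) ⟩
    p x             ∎
    where open ≤-Reasoning

  partner-far : ∀ {L x} → AllLengthsAtLeast C L → InRange N x → x + L ≤ p x ⊎ p x + L ≤ x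
  partner-far {L} {x} long x∈ with <-cmp x (p x)
  ... | tri< x<px _ _ = inj₁ (partner-above⇒far long x∈ x<px)
  ... | tri≈ _ x≡px _ = ⊥-elim (partner-nofix C x x∈ (sym x≡px))
  ... | tri> _ _ px<x = inj₂ (subst (λ y → p x + L ≤ y) (partner-invol C x x∈)
                          (partner-above⇒far long (partner-range C x x∈)
                            (subst (p x <_) (sym (partner-invol C x x∈)) px<x)))

  -- xs and the partners of its points are 2 · length xs distinct points among 2N.
  chord-free⇒length≤ : ∀ {xs} → Unique xs → All (InRange N) xs → All (λ x → p x ∉ xs) xs →
                       length xs ≤ N
  chord-free⇒length≤ {xs} u xs∈ chord-free = *-cancelˡ-≤ 2 (begin
    2 * length xs                        ≡⟨ cong (length xs +_) (+-identityʳ (length xs)) ⟩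
    length xs + length xs                ≡⟨ cong (length xs +_) (length-map p xs) ⟨
    length xs + length (map p xs)        ≡⟨ length-++ xs ⟨
    length (xs ++ map p xs)              ≤⟨ unique⇒length≤ (2 * N) unique-both (All.++⁺ xs∈ pxs∈) ⟩
    2 * N                                ∎)
    where
    open ≤-Reasoning
    pxs∈ : All (InRange N) (map p xs)
    pxs∈ = All.map⁺ (All.map (partner-range C _) xs∈)
    p∘p≡id : map p (map p xs) ≡ xs
    p∘p≡id = trans (sym (map-∘ xs)) (map-id-local (All.map (partner-invol C _) xs∈))
    unique-both : Unique (xs ++ map p xs)
    unique-both = Unique.++⁺ u (Unique.map⁻ (subst Unique (sym p∘p≡id) u)) λ (v∈xs , v∈pxs) →
      let (x , x∈xs , v≡px) = ∈-map⁻ p v∈pxs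
      in  All.lookup chord-free x∈xs (subst (_∈ xs) v≡px v∈xs)

  module _ {k : ℕ} (long : AllLengthsAtLeast C (k + 1))
           {sa : ℕ} (sa∈ : InRange N sa) (sa<e : sa < p sa) where

    private
      e = p sa
      t = e ∸ (k + 1)
      window = applyUpTo (λ i → e ∸ suc i) k

      sa+k+1≤e : sa + (k + 1) ≤ e
      sa+k+1≤e with partner-far long sa∈
      ... | inj₁ far = far
      ... | inj₂ near = ⊥-elim (<⇒≱ sa<e (m+n≤o⇒m≤o _ near))

      k+1≤e : k + 1 ≤ e
      k+1≤e = m+n≤o⇒n≤o sa sa+k+1≤e

      t+k+1≡e : t + (k + 1) ≡ e
      t+k+1≡e = m∸n+n≡m k+1≤e

      sa≤t : sa ≤ t
      sa≤t = m+n≤o⇒m≤o∸n sa sa+k+1≤e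

      below-e : ∀ {i} → i < k → suc i ≤ e
      below-e i<k = ≤-trans i<k (≤-trans (m≤m+n k 1) k+1≤e)

      in-window : All (λ y → t < y × y < e) window
      in-window = All.applyUpTo⁺₁ _ k λ {i} i<k →
        ∸-monoʳ-< (subst (suc i <_) (+-comm 1 k) (s≤s i<k)) k+1≤e ,
        ∸-monoʳ-< z<s (below-e i<k)

      window-unique : Unique window
      window-unique = Unique.applyUpTo⁺₁ _ k λ i<j j<k eq →
        <-irrefl (sym eq) (∸-monoʳ-< (s≤s i<j) (below-e j<k))

      window∈ : ∀ {y} → t < y × y < e → InRange N y
      window∈ (t<y , y<e) =
        ≤-trans (s≤s z≤n) t<y , ≤-trans (<⇒≤ y<e) (proj₂ (partner-range C sa sa∈))

      -- Q x forces p x into the region that Q excludes, so no chord has both ends satisfying Q.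
      Q : ℕ → Set
      Q x = x < e × (e ≤ p x ⊎ (t < x × p x < t))

      Q⇒¬Q-partner : ∀ {x} → InRange N x → Q x → ¬ Q (p x)
      Q⇒¬Q-partner _  (_ , inj₁ e≤px) (px<e , _) = <⇒≱ px<e e≤px
      Q⇒¬Q-partner x∈ (x<e , inj₂ _) (_ , inj₁ e≤ppx) =
        <⇒≱ x<e (subst (e ≤_) (partner-invol C _ x∈) e≤ppx)
      Q⇒¬Q-partner _  (_ , inj₂ (_ , px<t)) (_ , inj₂ (t<px , _)) = <-asym px<t t<px

      window-Q : ∀ {y} → t < y × y < e → Q y
      window-Q {y} (t<y , y<e) with partner-far long (window∈ (t<y , y<e))
      ... | inj₁ far = y<e , inj₁ (begin
        e              ≡⟨ t+k+1≡e ⟨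
        t + (k + 1)    ≤⟨ +-monoˡ-≤ (k + 1) (<⇒≤ t<y) ⟩
        y + (k + 1)    ≤⟨ far ⟩
        p y            ∎)
        where open ≤-Reasoning
      ... | inj₂ near = y<e , inj₂ (t<y , m+n≤o⇒m≤o∸n (suc (p y)) (≤-trans (s≤s near) y<e))

    count-before-chord : ∀ {xs} → Unique xs → All (InRange N) xs →
                         All (λ x → x < sa × partner C sa ≤ partner C x) xs →
                         length xs + suc k ≤ N
    count-before-chord {xs} u xs∈ before = begin
      length xs + suc k                ≡⟨ cong (λ l → length xs + suc l) (length-applyUpTo _ k) ⟨
      length xs + suc (length window)  ≡⟨ length-++ xs ⟨
      length (xs ++ sa ∷ window)       ≤⟨ chord-free⇒length≤ unique-all range-all chord-free ⟩
      N                                ∎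
      where
      open ≤-Reasoning
      all = xs ++ sa ∷ window
      unique-all : Unique all
      unique-all = Unique.++⁺ u
        (All.map (λ (t<y , _) → <⇒≢ (≤-<-trans sa≤t t<y)) in-window ∷ window-unique)
        (separated⇒disjoint (All.map proj₁ before)
                            (≤-refl ∷ All.map (λ (t<y , _) → ≤-trans sa≤t (<⇒≤ t<y)) in-window))
      range-all : All (InRange N) all
      range-all = All.++⁺ xs∈ (sa∈ ∷ All.map window∈ in-window)
      Q-all : All Q all
      Q-all = All.++⁺ (All.map (λ (x<sa , e≤px) → <-trans x<sa sa<e , inj₁ e≤px) before)
                      ((sa<e , inj₁ ≤-refl) ∷ All.map window-Q in-window)
      chord-free : All (λ x → p x ∉ all) all
      chord-free = All.map (λ (x∈ , qx) px∈all → Q⇒¬Q-partner x∈ qx (All.lookup Q-all px∈all))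
                           (All.zip (range-all , Q-all))

points-inRange : ∀ N → All (InRange N) (points N)
points-inRange N = All.map⁺ (All.tabulate λ i∈ → s≤s z≤n , ∈-upTo⁻ i∈)

points-unique : ∀ N → Unique (points N)
points-unique N = Unique.map⁺ suc-injective (Unique.upTo⁺ (2 * N))

lemma3 : (n k : ℕ) → 1 ≤ n → 1 ≤ k → 3 * (n ∸ k) ≤ n → k ≤ n →
         (C : ChordDiagram (suc n)) → AllLengthsAtLeast C (k + 1) →
         (sa : ℕ) → InRange (suc n) sa → partner C sa ≡ (2 * n ∸ k) + 2 → sa < (2 * n ∸ k) + 2 →
         countSBefore C n k sa < (n ∸ k) + 1
lemma3 n k _ _ _ _ C long sa sa∈ pa≡e sa<e = ≤-<-trans m≤n∸k (m<m+n (n ∸ k) z<s)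
  where
  E = 2 * n ∸ k
  p = partner C

  -- The filter predicate of countSBefore is local to its definition, so it is restated here
  -- in order to apply All.all-filter to the counted list.
  S-before? : (s : ℕ) →
              Dec (s < p s × ¬ (k + 2 ≤ s × s ≤ E + 1) × ¬ (k + 2 ≤ p s × p s ≤ E + 1) × s < sa)
  S-before? s = (s <? p s) ×-dec (¬? ((k + 2 ≤? s) ×-dec (s ≤? E + 1)))
                ×-dec (¬? ((k + 2 ≤? p s) ×-dec (p s ≤? E + 1))) ×-dec (s <? sa)

  S = filter S-before? (points (suc n))

  partner-beyond-M : ∀ {s} → InRange (suc n) s → s < p s → ¬ (k + 2 ≤ p s × p s ≤ E + 1) →
                     p sa ≤ p s
  partner-beyond-M {s} s∈ s<ps ps∉M =
    subst (_≤ p s) (trans (sym (+-suc E 1)) (sym pa≡e)) (≰⇒> λ ps≤E+1 → ps∉M (k+2≤ps , ps≤E+1))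
    where
    k+2≤ps : k + 2 ≤ p s
    k+2≤ps = subst (_≤ p s) (sym (+-suc k 1))
                   (≤-<-trans (long s s∈ s<ps) (∸-monoʳ-< (proj₁ s∈) (<⇒≤ s<ps)))

  before : All (λ s → s < sa × p sa ≤ p s) S
  before = All.map (λ (s∈ , (s<ps , _ , ps∉M , s<sa)) → s<sa , partner-beyond-M s∈ s<ps ps∉M)
    (All.zip (All.filter⁺ S-before? (points-inRange (suc n)) , All.all-filter S-before? _))

  m≤n∸k : length S ≤ n ∸ k
  m≤n∸k = m+n≤o⇒m≤o∸n (length S)
    (≤-pred (subst (_≤ suc n) (+-suc (length S) k)
      (count-before-chord C long sa∈ (subst (sa <_) (sym pa≡e) sa<e)
        (Unique.filter⁺ S-before? (points-unique (suc n)))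
        (All.filter⁺ S-before? (points-inRange (suc n))) before)))
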